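{- There is a function $l:\mathbb{N}\to\mathbb{N}$ such that for every $m$ and every graph $G$, every equivalence class of $\cong_m$ on $V(G)$ is a union of connected components of the graph of $\cong^D_{l(m)}$ on $V(G)$.
   Context: Graphs are finite, simple, undirected, loopless, possibly labelled by unary predicates. For $u,v\in V(G)$, $D(u,v)=N(u)\,\Delta\,N(v)$. $u\cong_m v$ means Duplicator wins the standard $m$-round Ehrenfeucht–Fraïssé game between $(G,u)$ and $(G,v)$. $u\cong^D_m v$ means Duplicator wins the $m$-round differential game on $G$ starting from $a_1=u$, $b_1=v$: in each round, with current tuples $(a_1,\dots,a_n)$, $(b_1,\dots,b_n)$, Spoiler chooses an index $i\le n$ and a vertex $w\in D(a_i,b_i)$ and declares whether $w$ becomes $a_{n+1}$ or $b_{n+1}$ (if all $D(a_i,b_i)$ are empty, Duplicator wins); Duplicator must reply with a vertex of $D(a_i,b_i)$ (same $i$), which becomes $b_{n+1}$, respectively $a_{n+1}$. At the end Duplicator wins iff for all $i,j$: $a_i=a_j\iff b_i=b_j$, $a_ia_j\in E\iff b_ib_j\in E$, and $a_i,b_i$ have the same labels. The graph of a relation $R$ on $V(G)$ has vertex set $V(G)$ and an edge between distinct $u,v$ whenever $uRv$. -}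

module Defs where

open import Data.Nat using (ℕ; zero; suc)
open import Data.Fin using (Fin)
open import Data.Bool using (Bool; true; false)
open import Data.Product using (Σ; _×_; _,_; proj₁; proj₂)
open import Data.Sum using (_⊎_)
open import Data.List using (List; []; _∷_)
open import Data.List.Membership.Propositional using (_∈_)
open import Data.Empty using (⊥)
open import Relation.Nullary using (¬_)
open import Relation.Binary.PropositionalEquality using (_≡_; _≢_)
open import Relation.Binary.Construct.Closure.ReflexiveTransitive using (Star)

record Graph : Set where
  field
    n     : ℕ
    k     : ℕ
    adj   : Fin n → Fin n → Bool
    sym   : ∀ u v → adj u v ≡ adj v u
    irr   : ∀ u → adj u u ≡ false
    label : Fin k → Fin n → Bool

open Graph public

V : Graph → Set
V G = Fin (n G)

-- w ∈ D(u,v) = N(u) Δ N(v)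
InD : (G : Graph) → V G → V G → V G → Set
InD G u v w = adj G u w ≢ adj G v w

Pos : Graph → Set
Pos G = List (V G × V G)

Cond : (G : Graph) → Pos G → Set
Cond G ps =
  ∀ {p q} → p ∈ ps → q ∈ ps →
    ((proj₁ p ≡ proj₁ q → proj₂ p ≡ proj₂ q) × (proj₂ p ≡ proj₂ q → proj₁ p ≡ proj₁ q))
    × (adj G (proj₁ p) (proj₁ q) ≡ adj G (proj₂ p) (proj₂ q))
    × (∀ (j : Fin (k G)) → label G j (proj₁ p) ≡ label G j (proj₂ p))

EFWin : (G : Graph) → ℕ → Pos G → Set
EFWin G zero    ps = Cond G ps
EFWin G (suc m) ps =
  (∀ (w : V G) → Σ (V G) λ w' → EFWin G m ((w , w') ∷ ps))
  × (∀ (w : V G) → Σ (V G) λ w' → EFWin G m ((w' , w) ∷ ps))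

EFEq : (G : Graph) → ℕ → V G → V G → Set
EFEq G m u v = EFWin G m ((u , v) ∷ [])

AllDEmpty : (G : Graph) → Pos G → Set
AllDEmpty G ps = ∀ {p} → p ∈ ps → ∀ (w : V G) → ¬ InD G (proj₁ p) (proj₂ p) w

-- Duplicator wins the m-round differential game from position ps.
-- If all D(a_i,b_i) are empty the game stops and the final condition is checked.
DWin : (G : Graph) → ℕ → Pos G → Set
DWin G zero    ps = Cond G ps
DWin G (suc m) ps =
  (AllDEmpty G ps → Cond G ps)
  × (∀ {p} → p ∈ ps → ∀ (w : V G) → InD G (proj₁ p) (proj₂ p) w →
       Σ (V G) λ w' → InD G (proj₁ p) (proj₂ p) w' × DWin G m ((w , w') ∷ ps))
  × (∀ {p} → p ∈ ps → ∀ (w : V G) → InD G (proj₁ p) (proj₂ p) w →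
       Σ (V G) λ w' → InD G (proj₁ p) (proj₂ p) w' × DWin G m ((w' , w) ∷ ps))

DEq : (G : Graph) → ℕ → V G → V G → Set
DEq G m u v = DWin G m ((u , v) ∷ [])

RelEdge : (G : Graph) → (V G → V G → Set) → V G → V G → Set
RelEdge G R u v = u ≢ v × (R u v ⊎ R v u)

SameComp : (G : Graph) → (V G → V G → Set) → V G → V G → Set
SameComp G R = Star (RelEdge G R)

module Submission where

-- Main step (simulate): if Duplicator wins the bound(m)-round differential
-- game from (u , v), she wins the m-round EF game from (u , v).  She keeps a
-- won, "tame" position S of the differential game containing all EF pairs.
-- Against an EF move x on the left she answers x's partner if x becomes a
-- left coordinate within bound(m)+1 differential rounds (Reach, follow);
-- otherwise she answers x itself, or u when x = v, and adds that pair to S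
-- (extend-partner), which keeps a bound(m)-round win because the pair stays
-- compatible with all positions her strategy reaches (extend).  Right moves
-- are left moves in the mirrored position.  The theorem follows since ≅_m is
-- reflexive, symmetric and transitive (EF-refl, EF-swap, EF-trans), hence
-- constant on connected components of the graph of ≅^D_{bound m}.

open import Defs
open import Data.Nat using (ℕ; zero; suc; _+_; _≤_; s≤s)
open import Data.Nat.Properties using (≤-refl; ≤-trans; ≤-pred; n≤1+n; m≤m+n; m≤n+m; +-cancelˡ-≤)
open import Data.Product using (Σ; _×_; _,_; proj₁; proj₂; swap)
open import Data.Sum using (_⊎_; inj₁; inj₂)
open import Data.List using (List; []; _∷_; map)
open import Data.List.Membership.Propositional using (_∈_)
open import Data.List.Membership.Propositional.Properties using (∈-map⁺; ∈-map⁻)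
open import Data.List.Relation.Unary.Any using (here; there)
open import Data.List.Relation.Binary.Subset.Propositional using (_⊆_)
open import Data.List.Relation.Binary.Subset.Propositional.Properties
  using (⊆-refl; ⊆-trans; xs⊆x∷xs; ∷⁺ʳ; map⁺; ⊆-reflexive-↭)
open import Data.List.Relation.Binary.Permutation.Propositional using (↭-swap; ↭-refl)
open import Data.Fin using (_≟_)
open import Data.Fin.Properties using (any?)
open import Data.Bool.Properties using () renaming (_≟_ to _≟ᵇ_)
open import Data.Empty using (⊥; ⊥-elim)
import Data.Empty.Irrelevant as Irrelevant
open import Relation.Nullary using (¬_; Dec; yes; no; ¬?)
open import Relation.Nullary.Decidable using (map′; decidable-stable; _⊎-dec_)
open import Relation.Binary.PropositionalEquality
  using (_≡_; _≢_; refl; cong; cong₂; subst; trans; module ≡-Reasoning) renaming (sym to ≡-sym)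
open import Relation.Binary.Construct.Closure.ReflexiveTransitive using (ε; _◅_)

-- The round bound l(m) = 2^m - 1: one simulated EF round costs at most
-- l(m) + 1 differential rounds and must leave l(m) rounds for the rest.
bound : ℕ → ℕ
bound zero    = zero
bound (suc m) = suc (bound m + bound m)

∃∈? : {A : Set} (S : List A) (Q : (p : A) → p ∈ S → Set) →
      (∀ p (p∈S : p ∈ S) → Dec (Q p p∈S)) → Dec (Σ A λ p → Σ (p ∈ S) (Q p))
∃∈? []      Q Q? = no λ { (_ , () , _) }
∃∈? (x ∷ S) Q Q? =
  map′ (λ { (inj₁ q) → x , here refl , q ; (inj₂ (p , p∈S , q)) → p , there p∈S , q })
       (λ { (_ , here refl , q) → inj₁ q ; (p , there p∈S , q) → inj₂ (p , p∈S , q) })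
       (Q? x (here refl) ⊎-dec ∃∈? S (λ p p∈S → Q p (there p∈S)) (λ p p∈S → Q? p (there p∈S)))

module _ (G : Graph) where

  infix 4 _∈D_

  _∈D_ : V G → V G × V G → Set
  z ∈D p = InD G (proj₁ p) (proj₂ p) z

  _∈D?_ : ∀ z p → Dec (z ∈D p)
  z ∈D? p = ¬? (adj G (proj₁ p) z ≟ᵇ adj G (proj₂ p) z)

  outside-D : ∀ {z p} → ¬ z ∈D p → adj G (proj₁ p) z ≡ adj G (proj₂ p) z
  outside-D {z} {p} = decidable-stable (adj G (proj₁ p) z ≟ᵇ adj G (proj₂ p) z)

  Cond-⊆ : ∀ {S T} → T ⊆ S → Cond G S → Cond G T
  Cond-⊆ T⊆S cond p∈T q∈T = cond (T⊆S p∈T) (T⊆S q∈T)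

  -- A position won in the differential game satisfies the winning condition:
  -- either the game stops at once, or it is a sub-position of a won position.
  DWin⇒Cond : ∀ r S → DWin G r S → Cond G S
  DWin⇒Cond zero    S win = win
  DWin⇒Cond (suc r) S win with ∃∈? S (λ p _ → Σ (V G) (_∈D p)) (λ p _ → any? (_∈D? p))
  ... | no noMove = proj₁ win (λ p∈S z z∈D → noMove (_ , p∈S , z , z∈D))
  ... | yes (p , p∈S , z , z∈D) =
    Cond-⊆ (xs⊆x∷xs S _) (DWin⇒Cond r _ (proj₂ (proj₂ (proj₁ (proj₂ win) p∈S z z∈D))))

  -- Duplicator's answer when Spoiler plays z on the left (ˡ) or on the right
  -- (ʳ) of the pair p.  The proof of z ∈ D(p) is irrelevant, so the position
  -- reached depends only on p, its membership proof and z.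
  answerˡ : ∀ {r S} → DWin G (suc r) S → ∀ {p} → p ∈ S → (z : V G) → .(z ∈D p) →
            Σ (V G) λ z' → z' ∈D p × DWin G r ((z , z') ∷ S)
  answerˡ win {p} p∈S z z∈D with z ∈D? p
  ... | yes z∈D' = proj₁ (proj₂ win) p∈S z z∈D'
  ... | no  z∉D  = Irrelevant.⊥-elim (z∉D z∈D)

  answerʳ : ∀ {r S} → DWin G (suc r) S → ∀ {p} → p ∈ S → (z : V G) → .(z ∈D p) →
            Σ (V G) λ z' → z' ∈D p × DWin G r ((z' , z) ∷ S)
  answerʳ win {p} p∈S z z∈D with z ∈D? p
  ... | yes z∈D' = proj₂ (proj₂ win) p∈S z z∈D'
  ... | no  z∉D  = Irrelevant.⊥-elim (z∉D z∈D)

  nextˡ : ∀ {r S} (win : DWin G (suc r) S) {p} (p∈S : p ∈ S) z .(z∈D : z ∈D p) →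
          DWin G r ((z , proj₁ (answerˡ win p∈S z z∈D)) ∷ S)
  nextˡ win p∈S z z∈D = proj₂ (proj₂ (answerˡ win p∈S z z∈D))

  nextʳ : ∀ {r S} (win : DWin G (suc r) S) {p} (p∈S : p ∈ S) z .(z∈D : z ∈D p) →
          DWin G r ((proj₁ (answerʳ win p∈S z z∈D) , z) ∷ S)
  nextʳ win p∈S z z∈D = proj₂ (proj₂ (answerʳ win p∈S z z∈D))

  DWin-≈ : ∀ r {S T} → T ⊆ S → S ⊆ T → DWin G r S → DWin G r T
  DWin-≈ zero    T⊆S S⊆T win = Cond-⊆ T⊆S win
  DWin-≈ (suc r) T⊆S S⊆T win =
    (λ noMove → Cond-⊆ T⊆S (proj₁ win (λ p∈S → noMove (S⊆T p∈S)))) ,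
    (λ p∈T z z∈D → let (z' , z'∈D , win') = proj₁ (proj₂ win) (T⊆S p∈T) z z∈D
                   in z' , z'∈D , DWin-≈ r (∷⁺ʳ _ T⊆S) (∷⁺ʳ _ S⊆T) win') ,
    (λ p∈T z z∈D → let (z' , z'∈D , win') = proj₂ (proj₂ win) (T⊆S p∈T) z z∈D
                   in z' , z'∈D , DWin-≈ r (∷⁺ʳ _ T⊆S) (∷⁺ʳ _ S⊆T) win')

  -- Difference sets are closed under partners: if (a , w) is played and
  -- a ∈ D(p), then w ∈ D(p), since Duplicator's answer to a inside D(p) must
  -- be a's partner w.
  partner-∈D : ∀ {r S} → DWin G (suc r) S → ∀ {p a w} → p ∈ S → (a , w) ∈ S → a ∈D p → w ∈D p
  partner-∈D {r} win p∈S aw∈S a∈D =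
    let (a' , a'∈D , win') = answerˡ win p∈S _ a∈D
        a'≡w = proj₁ (proj₁ (DWin⇒Cond r _ win' (here refl) (there aw∈S))) refl
    in subst (_∈D _) a'≡w a'∈D

  Compatible : V G × V G → V G × V G → Set
  Compatible q p = ((proj₁ q ≡ proj₁ p → proj₂ q ≡ proj₂ p) × (proj₂ q ≡ proj₂ p → proj₁ q ≡ proj₁ p))
                   × (adj G (proj₁ q) (proj₁ p) ≡ adj G (proj₂ q) (proj₂ p))

  LabelsAgree : V G × V G → Set
  LabelsAgree q = ∀ j → label G j (proj₁ q) ≡ label G j (proj₂ q)

  Cond-∷ : ∀ {S} q → Cond G S → (∀ {p} → p ∈ S → Compatible q p) → LabelsAgree q → Cond G (q ∷ S)
  Cond-∷ q cond compat lab (here refl) (here refl) =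
    ((λ _ → refl) , (λ _ → refl)) , trans (irr G _) (≡-sym (irr G _)) , lab
  Cond-∷ q cond compat lab (here refl) (there q∈S) = proj₁ (compat q∈S) , proj₂ (compat q∈S) , lab
  Cond-∷ q cond compat lab (there p∈S) (here refl) =
    let ((to , from) , adjacency) = compat p∈S
    in ((λ e → ≡-sym (to (≡-sym e))) , (λ e → ≡-sym (from (≡-sym e)))) ,
       trans (sym G _ _) (trans adjacency (sym G _ _)) , proj₂ (proj₂ (cond p∈S p∈S))
  Cond-∷ q cond compat lab (there p∈S) (there q∈S) = cond p∈S q∈S

  swapped : Pos G → Pos G
  swapped = map swap

  swapped-⊆ : ∀ {S} → S ⊆ swapped (swapped S)
  swapped-⊆ p∈S = ∈-map⁺ swap (∈-map⁺ swap p∈S)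

  Cond-swap : ∀ S → Cond G S → Cond G (swapped S)
  Cond-swap S cond p∈ q∈ with ∈-map⁻ swap p∈ | ∈-map⁻ swap q∈
  ... | (p , p∈S , refl) | (q , q∈S , refl) =
    let ((to , from) , adjacency , labels) = cond p∈S q∈S
    in (from , to) , ≡-sym adjacency , λ j → ≡-sym (labels j)

  DWin-swap : ∀ r S → DWin G r S → DWin G r (swapped S)
  DWin-swap zero    S win = Cond-swap S win
  DWin-swap (suc r) S win =
    (λ noMove → Cond-swap S (proj₁ win (λ p∈S z z∈D → noMove (∈-map⁺ swap p∈S) z (λ e → z∈D (≡-sym e))))) ,
    (λ p∈ z z∈D → mirror p∈ z z∈D (λ z z' → z' , z) (proj₂ (proj₂ win))) ,
    (λ p∈ z z∈D → mirror p∈ z z∈D _,_ (proj₁ (proj₂ win)))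
    where
    mirror : ∀ {p} → p ∈ swapped S → ∀ z → z ∈D p → (pair : V G → V G → V G × V G) →
             (∀ {p₀} → p₀ ∈ S → ∀ z → z ∈D p₀ → Σ (V G) λ z' → z' ∈D p₀ × DWin G r (pair z z' ∷ S)) →
             Σ (V G) λ z' → z' ∈D p × DWin G r (swap (pair z z') ∷ swapped S)
    mirror p∈ z z∈D pair move with ∈-map⁻ swap p∈
    ... | (p₀ , p₀∈S , refl) =
      let (z' , z'∈D , win') = move p₀∈S z (λ e → z∈D (≡-sym e))
      in z' , (λ e → z'∈D (≡-sym e)) , DWin-swap r _ win'

  EF-swap : ∀ m Q → EFWin G m Q → EFWin G m (swapped Q)
  EF-swap zero    Q win = Cond-swap Q win
  EF-swap (suc m) Q win =
    (λ w → let (w' , win') = proj₂ win w in w' , EF-swap m _ win') ,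
    (λ w → let (w' , win') = proj₁ win w in w' , EF-swap m _ win')

  EF-⊆ : ∀ m {S T} → T ⊆ S → EFWin G m S → EFWin G m T
  EF-⊆ zero    T⊆S win = Cond-⊆ T⊆S win
  EF-⊆ (suc m) T⊆S win =
    (λ w → let (w' , win') = proj₁ win w in w' , EF-⊆ m (∷⁺ʳ _ T⊆S) win') ,
    (λ w → let (w' , win') = proj₂ win w in w' , EF-⊆ m (∷⁺ʳ _ T⊆S) win')

  -- q stays compatible with every pair of every position Duplicator's
  -- strategy can reach within h rounds.
  StaysCompatible : ℕ → (r : ℕ) (S : Pos G) → DWin G r S → V G × V G → Set
  StaysCompatible zero    r       S win q = ∀ {p} → p ∈ S → Compatible q p
  StaysCompatible (suc h) zero    S win q = ⊥
  StaysCompatible (suc h) (suc r) S win q = (∀ {p} → p ∈ S → Compatible q p) ×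
    (∀ {p} (p∈S : p ∈ S) z (z∈D : z ∈D p) →
       StaysCompatible h r _ (nextˡ win p∈S z z∈D) q × StaysCompatible h r _ (nextʳ win p∈S z z∈D) q)

  -- Every element of D(q) lies in some D(p), p ∈ S, with D(p) ⊆ D(q): a move
  -- on q can be simulated by a move on p.
  Covered : V G × V G → Pos G → Set
  Covered q S = ∀ z → z ∈D q → Σ (V G × V G) λ p → p ∈ S × z ∈D p × (∀ z' → z' ∈D p → z' ∈D q)

  Covered-∷ : ∀ {q S} p → Covered q S → Covered q (p ∷ S)
  Covered-∷ p cover z z∈D = let (p₀ , p₀∈S , z∈D₀ , D₀⊆D) = cover z z∈D in p₀ , there p₀∈S , z∈D₀ , D₀⊆D

  simulatingPair : ∀ {q S} → Covered q S → ∀ {p} → p ∈ q ∷ S → ∀ z → z ∈D p →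
                   Σ (V G × V G) λ p₀ → p₀ ∈ S × z ∈D p₀ × (∀ z' → z' ∈D p₀ → z' ∈D p)
  simulatingPair cover (here refl) z z∈D = cover z z∈D
  simulatingPair cover (there p∈S) z z∈D = _ , p∈S , z∈D , λ _ z'∈D → z'∈D

  -- Moves on q are answered as the simulating moves on pairs of S.
  extend : ∀ h r S (win : DWin G r S) q → h ≤ r → StaysCompatible h r S win q → LabelsAgree q →
           Covered q S → DWin G h (q ∷ S)
  extend zero    r       S win q _         compat lab cover = Cond-∷ q (DWin⇒Cond r S win) compat lab
  extend (suc h) (suc r) S win q (s≤s h≤r) compat lab cover =
    (λ _ → Cond-∷ q (DWin⇒Cond (suc r) S win) (proj₁ compat) lab) ,
    (λ p∈ z z∈D → let (p₀ , p₀∈S , z∈D₀ , D₀⊆D) = simulatingPair cover p∈ z z∈D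
                      (z' , z'∈D₀ , _) = answerˡ win p₀∈S z z∈D₀
                  in z' , D₀⊆D z' z'∈D₀ ,
                     reorder (extend h r _ (nextˡ win p₀∈S z z∈D₀) q h≤r
                                     (proj₁ (proj₂ compat p₀∈S z z∈D₀)) lab cover′)) ,
    (λ p∈ z z∈D → let (p₀ , p₀∈S , z∈D₀ , D₀⊆D) = simulatingPair cover p∈ z z∈D
                      (z' , z'∈D₀ , _) = answerʳ win p₀∈S z z∈D₀
                  in z' , D₀⊆D z' z'∈D₀ ,
                     reorder (extend h r _ (nextʳ win p₀∈S z z∈D₀) q h≤r
                                     (proj₂ (proj₂ compat p₀∈S z z∈D₀)) lab cover′))
    where
    cover′ : ∀ {p} → Covered q (p ∷ S)
    cover′ = Covered-∷ _ cover

    reorder : ∀ {p T} → DWin G h (q ∷ p ∷ T) → DWin G h (p ∷ q ∷ T)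
    reorder = DWin-≈ h (⊆-reflexive-↭ (↭-swap _ _ ↭-refl)) (⊆-reflexive-↭ (↭-swap _ _ ↭-refl))

  Occursˡ Occursʳ : V G → Pos G → Set
  Occursˡ x S = Σ (V G) λ c → (x , c) ∈ S
  Occursʳ x S = Σ (V G) λ c → (c , x) ∈ S

  Occursˡ? : ∀ x S → Dec (Occursˡ x S)
  Occursˡ? x S = map′ (λ { (p , p∈S , refl) → proj₂ p , p∈S }) (λ (c , xc∈S) → _ , xc∈S , refl)
                      (∃∈? S (λ p _ → proj₁ p ≡ x) (λ p _ → proj₁ p ≟ x))

  Occursʳ? : ∀ x S → Dec (Occursʳ x S)
  Occursʳ? x S = map′ (λ { (p , p∈S , refl) → proj₁ p , p∈S }) (λ (c , cx∈S) → _ , cx∈S , refl)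
                      (∃∈? S (λ p _ → proj₂ p ≡ x) (λ p _ → proj₂ p ≟ x))

  -- x becomes a left coordinate within K further rounds of the differential
  -- game, for some choice of Spoiler's moves answered by the strategy win.
  Reach : ℕ → (r : ℕ) (S : Pos G) → DWin G r S → V G → Set
  ReachByMove : ℕ → (r : ℕ) (S : Pos G) → DWin G r S → V G → Set
  Reach K r S win x = Occursˡ x S ⊎ ReachByMove K r S win x
  ReachByMove zero    r       S win x = ⊥
  ReachByMove (suc K) zero    S win x = ⊥
  ReachByMove (suc K) (suc r) S win x =
    Σ (V G × V G) λ p → Σ (p ∈ S) λ p∈S → Σ (V G) λ z → Σ (z ∈D p) λ z∈D →
      Reach K r _ (nextˡ win p∈S z z∈D) x ⊎ Reach K r _ (nextʳ win p∈S z z∈D) x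

  Reach? : ∀ K r S win x → Dec (Reach K r S win x)
  ReachByMove? : ∀ K r S win x → Dec (ReachByMove K r S win x)
  Reach? K r S win x = Occursˡ? x S ⊎-dec ReachByMove? K r S win x
  ReachByMove? zero    r       S win x = no λ ()
  ReachByMove? (suc K) zero    S win x = no λ ()
  ReachByMove? (suc K) (suc r) S win x = ∃∈? S _ (λ p p∈S → any? (move? p p∈S))
    where
    ReachAfter : ∀ p → p ∈ S → ∀ z → z ∈D p → Set
    ReachAfter p p∈S z z∈D = Reach K r _ (nextˡ win p∈S z z∈D) x ⊎ Reach K r _ (nextʳ win p∈S z z∈D) x

    -- by irrelevance, ReachAfter does not depend on the proof of z ∈ D(p)
    move? : ∀ p (p∈S : p ∈ S) z → Dec (Σ (z ∈D p) (ReachAfter p p∈S z))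
    move? p p∈S z = decide (z ∈D? p)
      where
      decide : Dec (z ∈D p) → Dec (Σ (z ∈D p) (ReachAfter p p∈S z))
      decide (no  z∉D) = no λ (z∈D , _) → z∉D z∈D
      decide (yes z∈D) = map′ (z∈D ,_) proj₂
        (Reach? K r _ (nextˡ win p∈S z z∈D) x ⊎-dec Reach? K r _ (nextʳ win p∈S z z∈D) x)

  reach-∈D : ∀ K r S (win : DWin G (suc r) S) x {p} → p ∈ S → x ∈D p → Reach (suc K) (suc r) S win x
  reach-∈D K r S win x p∈S x∈D = inj₂ (_ , p∈S , x , x∈D , inj₁ (inj₁ (_ , here refl)))

  InSomeD : V G → Pos G → Set
  InSomeD x S = Σ (V G × V G) λ p → p ∈ S × x ∈D p

  TamePair : V G → V G → Pos G → V G × V G → Set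
  TamePair u v S p = (proj₁ p ≡ proj₂ p) ⊎ (InSomeD (proj₁ p) S × InSomeD (proj₂ p) S)
                     ⊎ (p ≡ (u , v)) ⊎ (p ≡ (v , u))

  Tame : V G → V G → Pos G → Set
  Tame u v S = (u , v) ∈ S × (∀ {p} → p ∈ S → TamePair u v S p)

  initial-tame : ∀ u v → Tame u v ((u , v) ∷ [])
  initial-tame u v = here refl , λ { (here refl) → inj₂ (inj₂ (inj₁ refl)) ; (there ()) }

  TamePair-⊆ : ∀ {u v S T p} → S ⊆ T → TamePair u v S p → TamePair u v T p
  TamePair-⊆ S⊆T (inj₁ e) = inj₁ e
  TamePair-⊆ S⊆T (inj₂ (inj₁ ((p , p∈S , a∈D) , (q , q∈S , b∈D)))) =
    inj₂ (inj₁ ((p , S⊆T p∈S , a∈D) , (q , S⊆T q∈S , b∈D)))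
  TamePair-⊆ S⊆T (inj₂ (inj₂ e)) = inj₂ (inj₂ e)

  Tame-∷ : ∀ {u v S} q → TamePair u v (q ∷ S) q → Tame u v S → Tame u v (q ∷ S)
  Tame-∷ q tameq (uv∈S , tamePairs) =
    there uv∈S , λ { (here refl) → tameq ; (there p∈S) → TamePair-⊆ (xs⊆x∷xs _ q) (tamePairs p∈S) }

  played-tame : ∀ {u v S p a b} → p ∈ S → a ∈D p → b ∈D p → TamePair u v ((a , b) ∷ S) (a , b)
  played-tame p∈S a∈D b∈D = inj₂ (inj₁ ((_ , there p∈S , a∈D) , (_ , there p∈S , b∈D)))

  Tame-swap : ∀ {u v S} → Tame u v S → Tame v u (swapped S)
  Tame-swap {u} {v} {S} (uv∈S , tamePairs) = ∈-map⁺ swap uv∈S , mirrored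
    where
    InSomeD-swap : ∀ {x} → InSomeD x S → InSomeD x (swapped S)
    InSomeD-swap (q , q∈S , x∈D) = swap q , ∈-map⁺ swap q∈S , λ e → x∈D (≡-sym e)

    mirrored : ∀ {p} → p ∈ swapped S → TamePair v u (swapped S) p
    mirrored p∈ with ∈-map⁻ swap p∈
    ... | (p₀ , p₀∈S , refl) with tamePairs p₀∈S
    ...   | inj₁ e = inj₁ (≡-sym e)
    ...   | inj₂ (inj₁ (a , b)) = inj₂ (inj₁ (InSomeD-swap b , InSomeD-swap a))
    ...   | inj₂ (inj₂ (inj₁ refl)) = inj₂ (inj₂ (inj₁ refl))
    ...   | inj₂ (inj₂ (inj₂ refl)) = inj₂ (inj₂ (inj₂ refl))

  record Continuation (u v : V G) (S : Pos G) : Set where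
    field
      rounds : ℕ
      pos    : Pos G
      won    : DWin G rounds pos
      grows  : S ⊆ pos
      isTame : Tame u v pos
  open Continuation

  from-smaller : ∀ {u v S T} → S ⊆ T → Continuation u v T → Continuation u v S
  from-smaller S⊆T c = record
    { rounds = rounds c ; pos = pos c ; won = won c ; grows = ⊆-trans S⊆T (grows c) ; isTame = isTame c }

  follow : ∀ {u v} K r S (win : DWin G r S) x → Tame u v S → Reach K r S win x →
           Σ (Continuation u v S) λ c → r ≤ K + rounds c × Occursˡ x (pos c)
  follow K r S win x tame (inj₁ occ) =
    record { rounds = r ; pos = S ; won = win ; grows = ⊆-refl ; isTame = tame } , m≤n+m r K , occ
  follow (suc K) (suc r) S win x tame (inj₂ (p , p∈S , z , z∈D , inj₁ R)) =
    let (z' , z'∈D , _) = answerˡ win p∈S z z∈D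
        (c , r≤ , occ) = follow K r _ (nextˡ win p∈S z z∈D) x (Tame-∷ _ (played-tame p∈S z∈D z'∈D) tame) R
    in from-smaller (xs⊆x∷xs S _) c , s≤s r≤ , occ
  follow (suc K) (suc r) S win x tame (inj₂ (p , p∈S , z , z∈D , inj₂ R)) =
    let (z' , z'∈D , _) = answerʳ win p∈S z z∈D
        (c , r≤ , occ) = follow K r _ (nextʳ win p∈S z z∈D) x (Tame-∷ _ (played-tame p∈S z'∈D z∈D) tame) R
    in from-smaller (xs⊆x∷xs S _) c , s≤s r≤ , occ

  Partnered : V G → V G → Pos G → Set
  Partnered x y S = x ≡ y ⊎ (y , x) ∈ S

  Partnered-∷ : ∀ {x y S} q → Partnered x y S → Partnered x y (q ∷ S)
  Partnered-∷ q (inj₁ x≡y)  = inj₁ x≡y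
  Partnered-∷ q (inj₂ yx∈S) = inj₂ (there yx∈S)

  partner-∉D : ∀ {r S} → DWin G (suc r) S → ∀ {x y p} → Partnered x y S → p ∈ S → ¬ x ∈D p → ¬ y ∈D p
  partner-∉D win (inj₁ refl)  p∈S x∉D = x∉D
  partner-∉D win (inj₂ yx∈S) p∈S x∉D y∈D = x∉D (partner-∈D win p∈S yx∈S y∈D)

  partner-labels : ∀ {S x y} → Cond G S → Partnered x y S → LabelsAgree (x , y)
  partner-labels cond (inj₁ refl)  j = refl
  partner-labels cond (inj₂ yx∈S) j = ≡-sym (proj₂ (proj₂ (cond yx∈S yx∈S)) j)

  -- D(x , y) is empty if y = x, and equals D(y , x) if (y , x) is played.
  partner-covered : ∀ {S x y} → Partnered x y S → Covered (x , y) S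
  partner-covered (inj₁ refl)  z z∈D = ⊥-elim (z∈D refl)
  partner-covered (inj₂ yx∈S) z z∈D = _ , yx∈S , (λ e → z∈D (≡-sym e)) , λ z' z'∈D e → z'∈D (≡-sym e)

  -- If x cannot be reached and y is no right coordinate, then (x , y) is
  -- compatible with every pair p of S: x, y ∉ D(p), so x and y see p as
  -- x's partner y sees it.
  partner-compatible : ∀ h r S (win : DWin G (suc r) S) {x y} → ¬ Reach (suc h) (suc r) S win x →
                       ¬ Occursʳ y S → Partnered x y S → ∀ {p} → p ∈ S → Compatible (x , y) p
  partner-compatible h r S win {x} {y} unreach notʳ partner {p} p∈S =
    ((λ x≡ → ⊥-elim (unreach (inj₁ (proj₂ p , subst (λ a → (a , proj₂ p) ∈ S) (≡-sym x≡) p∈S)))) ,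
     (λ y≡ → ⊥-elim (notʳ (proj₁ p , subst (λ b → (proj₁ p , b) ∈ S) (≡-sym y≡) p∈S)))) ,
    adjacency
    where
    open ≡-Reasoning
    x∉D : ¬ x ∈D p
    x∉D x∈D = unreach (reach-∈D h r S win x p∈S x∈D)

    y∉D : ¬ y ∈D p
    y∉D = partner-∉D win partner p∈S x∉D

    partner-adj : Partnered x y S → adj G x (proj₂ p) ≡ adj G y (proj₂ p)
    partner-adj (inj₁ refl)  = refl
    partner-adj (inj₂ yx∈S) = begin
      adj G x (proj₂ p) ≡⟨ ≡-sym (proj₁ (proj₂ (DWin⇒Cond (suc r) S win yx∈S p∈S))) ⟩
      adj G y (proj₁ p) ≡⟨ sym G y _ ⟩
      adj G (proj₁ p) y ≡⟨ outside-D y∉D ⟩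
      adj G (proj₂ p) y ≡⟨ sym G _ y ⟩
      adj G y (proj₂ p) ∎

    adjacency : adj G x (proj₁ p) ≡ adj G y (proj₂ p)
    adjacency = begin
      adj G x (proj₁ p) ≡⟨ sym G x _ ⟩
      adj G (proj₁ p) x ≡⟨ outside-D x∉D ⟩
      adj G (proj₂ p) x ≡⟨ sym G _ x ⟩
      adj G x (proj₂ p) ≡⟨ partner-adj partner ⟩
      adj G y (proj₂ p) ∎

  -- The hypotheses of partner-compatible persist for h rounds: x stays
  -- unreachable, and a newly played right coordinate lies in some D(p),
  -- which y avoids.
  partner-stays : ∀ h r S (win : DWin G r S) {x y} → suc h ≤ r → ¬ Reach (suc h) r S win x →
                  ¬ Occursʳ y S → Partnered x y S → StaysCompatible h r S win (x , y)
  partner-stays zero    (suc r) S win (s≤s _) unreach notʳ partner =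
    partner-compatible zero r S win unreach notʳ partner
  partner-stays (suc h) (suc r) S win {x} {y} (s≤s h<r) unreach notʳ partner =
    partner-compatible (suc h) r S win unreach notʳ partner ,
    λ p∈S z z∈D →
      partner-stays h r _ (nextˡ win p∈S z z∈D) h<r (λ R → unreach (inj₂ (_ , p∈S , z , z∈D , inj₁ R)))
        (notʳ-∷ p∈S (proj₁ (proj₂ (answerˡ win p∈S z z∈D)))) (Partnered-∷ _ partner) ,
      partner-stays h r _ (nextʳ win p∈S z z∈D) h<r (λ R → unreach (inj₂ (_ , p∈S , z , z∈D , inj₂ R)))
        (notʳ-∷ p∈S z∈D) (Partnered-∷ _ partner)
    where
    y∉D : ∀ {p} → p ∈ S → ¬ y ∈D p
    y∉D p∈S = partner-∉D win partner p∈S (λ x∈D → unreach (reach-∈D (suc h) r S win x p∈S x∈D))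

    notʳ-∷ : ∀ {p a b} → p ∈ S → b ∈D p → ¬ Occursʳ y ((a , b) ∷ S)
    notʳ-∷ p∈S b∈D (c , here e)     = y∉D p∈S (subst (_∈D _) (≡-sym (cong proj₂ e)) b∈D)
    notʳ-∷ p∈S b∈D (c , there cy∈S) = notʳ (c , cy∈S)

  extend-partner : ∀ h r S (win : DWin G (suc r) S) {x y} → h ≤ r → ¬ Reach (suc h) (suc r) S win x →
                   ¬ Occursʳ y S → Partnered x y S → DWin G h ((x , y) ∷ S)
  extend-partner h r S win h≤r unreach notʳ partner =
    extend h (suc r) S win _ (≤-trans h≤r (n≤1+n r)) (partner-stays h (suc r) S win (s≤s h≤r) unreach notʳ partner)
      (partner-labels (DWin⇒Cond (suc r) S win) partner) (partner-covered partner)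

  unreachable-right : ∀ {u v} h r S (win : DWin G (suc r) S) {a x} → Tame u v S →
                      ¬ Reach (suc h) (suc r) S win x → (a , x) ∈ S → (a , x) ≡ (u , v)
  unreachable-right h r S win (uv∈S , tamePairs) unreach ax∈S with tamePairs ax∈S
  ... | inj₁ refl                      = ⊥-elim (unreach (inj₁ (_ , ax∈S)))
  ... | inj₂ (inj₁ (_ , (q , q∈S , x∈D))) = ⊥-elim (unreach (reach-∈D h r S win _ q∈S x∈D))
  ... | inj₂ (inj₂ (inj₁ ax≡uv))       = ax≡uv
  ... | inj₂ (inj₂ (inj₂ refl))        = ⊥-elim (unreach (inj₁ (_ , uv∈S)))

  initial-free : ∀ {u v} h r S (win : DWin G (suc r) S) → Tame u v S →
                 ¬ Reach (suc h) (suc r) S win v → ¬ Occursʳ u S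
  initial-free {u} {v} h r S win (uv∈S , tamePairs) unreach (c , cu∈S) = excluded (tamePairs cu∈S)
    where
    u≢v : u ≢ v
    u≢v u≡v = unreach (inj₁ (_ , subst (λ a → (a , v) ∈ S) u≡v uv∈S))

    excluded : TamePair u v S (c , u) → ⊥
    excluded (inj₁ c≡u) =
      u≢v (proj₁ (proj₁ (DWin⇒Cond (suc r) S win (subst (λ a → (a , u) ∈ S) c≡u cu∈S) uv∈S)) refl)
    excluded (inj₂ (inj₁ (_ , (q , q∈S , u∈D)))) = unreach (reach-∈D h r S win v q∈S (partner-∈D win q∈S uv∈S u∈D))
    excluded (inj₂ (inj₂ (inj₁ cu≡uv))) = u≢v (cong proj₂ cu≡uv)
    excluded (inj₂ (inj₂ (inj₂ cu≡vu))) = unreach (inj₁ (_ , subst (λ a → (a , u) ∈ S) (cong proj₁ cu≡vu) cu∈S))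

  extended : ∀ {u v S} h q → DWin G h (q ∷ S) → TamePair u v (q ∷ S) q → Tame u v S → Continuation u v S
  extended {S = S} h q win tameq tame =
    record { rounds = h ; pos = q ∷ S ; won = win ; grows = xs⊆x∷xs S q ; isTame = Tame-∷ q tameq tame }

  -- The
  -- answer is x's eventual partner if x is reachable within h + 1 rounds,
  -- else x itself, or u if x = v is v's partner in the initial pair.
  respondˡ : ∀ {u v} h r S (win : DWin G r S) → suc (h + h) ≤ r → Tame u v S → ∀ x →
             Σ (V G) λ x' → Σ (Continuation u v S) λ c → h ≤ rounds c × (x , x') ∈ pos c
  respondˡ h (suc r) S win (s≤s 2h≤r) tame x with Reach? (suc h) (suc r) S win x
  ... | yes R =
    let (c , r≤ , (x' , xx'∈)) = follow (suc h) (suc r) S win x tame R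
    in x' , c , +-cancelˡ-≤ h h (rounds c) (≤-trans 2h≤r (≤-pred r≤)) , xx'∈
  ... | no unreach with Occursʳ? x S
  ...   | no notʳ =
    x , extended h _ (extend-partner h r S win (≤-trans (m≤m+n h h) 2h≤r) unreach notʳ (inj₁ refl)) (inj₁ refl) tame ,
    ≤-refl , here refl
  ...   | yes (a , ax∈S) with unreachable-right h r S win tame unreach ax∈S
  ...     | refl =
    a , extended h _ (extend-partner h r S win (≤-trans (m≤m+n h h) 2h≤r) unreach (initial-free h r S win tame unreach)
                       (inj₂ (proj₁ tame)))
                     (inj₂ (inj₂ (inj₂ refl))) tame ,
    ≤-refl , here refl

  -- Simulation: a tame position won for bound m differential rounds wins
  -- the m-round EF game from any of its sub-positions.  Right moves are
  -- left moves in the mirrored position.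
  simulate : ∀ m {u v} r S (win : DWin G r S) → bound m ≤ r → Tame u v S → ∀ Q → Q ⊆ S → EFWin G m Q
  simulateˡ : ∀ m {u v} r S (win : DWin G r S) → bound (suc m) ≤ r → Tame u v S → ∀ Q → Q ⊆ S →
              ∀ w → Σ (V G) λ w' → EFWin G m ((w , w') ∷ Q)

  simulate zero    r S win _ tame Q Q⊆S = Cond-⊆ Q⊆S (DWin⇒Cond r S win)
  simulate (suc m) r S win l≤r tame Q Q⊆S =
    simulateˡ m r S win l≤r tame Q Q⊆S ,
    λ w → let (w' , mirrorWin) = simulateˡ m r (swapped S) (DWin-swap r S win) l≤r (Tame-swap tame)
                                            (swapped Q) (map⁺ swap Q⊆S) w
          in w' , EF-⊆ m (∷⁺ʳ _ swapped-⊆) (EF-swap m _ mirrorWin)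

  simulateˡ m r S win l≤r tame Q Q⊆S w =
    let (w' , c , l≤ , ww'∈) = respondˡ (bound m) r S win l≤r tame w
    in w' , simulate m (rounds c) (pos c) (won c) l≤ (isTame c) ((w , w') ∷ Q)
                     (λ { (here refl) → ww'∈ ; (there q∈Q) → grows c (Q⊆S q∈Q) })

  DEq⇒EFEq : ∀ m u v → DEq G (bound m) u v → EFEq G m u v
  DEq⇒EFEq m u v win = simulate m (bound m) _ win ≤-refl (initial-tame u v) _ ⊆-refl

  data Composed : Pos G → Pos G → Pos G → Set where
    []  : Composed [] [] []
    _∷_ : ∀ {P P′ T} (abc : V G × V G × V G) → Composed P P′ T →
          let (a , b , c) = abc in Composed ((a , b) ∷ P) ((b , c) ∷ P′) ((a , c) ∷ T)

  composed-∈ : ∀ {P P′ T p} → Composed P P′ T → p ∈ T →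
               Σ (V G) λ b → (proj₁ p , b) ∈ P × (b , proj₂ p) ∈ P′
  composed-∈ (_ ∷ _)  (here refl) = _ , here refl , here refl
  composed-∈ (_ ∷ PT) (there p∈T) = let (b , ab∈ , bc∈) = composed-∈ PT p∈T in b , there ab∈ , there bc∈

  -- EF games compose: Duplicator plays the two strategies one after the other.
  EF-trans : ∀ m {P P′ T} → Composed P P′ T → EFWin G m P → EFWin G m P′ → EFWin G m T
  EF-trans zero PT win₁ win₂ p∈T q∈T =
    let (_ , p₁ , p₂) = composed-∈ PT p∈T
        (_ , q₁ , q₂) = composed-∈ PT q∈T
        ((to₁ , from₁) , adj₁ , lab₁) = win₁ p₁ q₁
        ((to₂ , from₂) , adj₂ , lab₂) = win₂ p₂ q₂
    in ((λ e → to₂ (to₁ e)) , (λ e → from₁ (from₂ e))) , trans adj₁ adj₂ , λ j → trans (lab₁ j) (lab₂ j)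
  EF-trans (suc m) PT win₁ win₂ =
    (λ w → let (w₁ , win₁') = proj₁ win₁ w
               (w₂ , win₂') = proj₁ win₂ w₁
           in w₂ , EF-trans m ((w , w₁ , w₂) ∷ PT) win₁' win₂') ,
    (λ w → let (w₁ , win₂') = proj₂ win₂ w
               (w₂ , win₁') = proj₂ win₁ w₁
           in w₂ , EF-trans m ((w₂ , w₁ , w) ∷ PT) win₁' win₂')

  -- Identity positions are won: Duplicator copies Spoiler.
  EF-refl : ∀ m T → (∀ {p} → p ∈ T → proj₁ p ≡ proj₂ p) → EFWin G m T
  EF-refl zero T diagonal p∈T q∈T =
    let p₁≡p₂ = diagonal p∈T ; q₁≡q₂ = diagonal q∈T
    in ((λ e → trans (≡-sym p₁≡p₂) (trans e q₁≡q₂)) , (λ e → trans p₁≡p₂ (trans e (≡-sym q₁≡q₂)))) ,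
       cong₂ (adj G) p₁≡p₂ q₁≡q₂ , λ j → cong (label G j) p₁≡p₂
  EF-refl (suc m) T diagonal =
    (λ w → w , EF-refl m _ λ { (here refl) → refl ; (there p∈T) → diagonal p∈T }) ,
    (λ w → w , EF-refl m _ λ { (here refl) → refl ; (there p∈T) → diagonal p∈T })

  component⇒EFEq : ∀ m u v → SameComp G (DEq G (bound m)) u v → EFEq G m u v
  component⇒EFEq m u .u ε = EF-refl m _ λ { (here refl) → refl ; (there ()) }
  component⇒EFEq m u v (_◅_ {j = w} (_ , uw∨wu) rest) =
    EF-trans m ((u , w , v) ∷ []) (edge uw∨wu) (component⇒EFEq m w v rest)
    where
    edge : DEq G (bound m) u w ⊎ DEq G (bound m) w u → EFEq G m u w
    edge (inj₁ uw) = DEq⇒EFEq m u w uw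
    edge (inj₂ wu) = EF-swap m _ (DEq⇒EFEq m w u wu)

lemma6p1 : Σ (ℕ → ℕ) λ l →
    ∀ (m : ℕ) (G : Graph) (u v : V G) →
      SameComp G (DEq G (l m)) u v → EFEq G m u v
lemma6p1 = bound , λ m G u v → component⇒EFEq G m u v
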